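{- Let $\Sigma$ be a signature and $(F,i)$ a filter pair over $\Sigma$. Define $I_{(F,i)}=\langle\mathit{Sig}_I,\mathit{Sen}_I,\mathit{Mod}_I,\models\rangle$ by: $\mathit{Sig}_I=\Sigma\text{ -str}$; $\mathit{Sen}_I:\Sigma\text{ -str}\to\mathbf{Set}$ the forgetful functor; $\mathit{Mod}_I:(\Sigma\text{ -str})^{op}\to\mathbf{CAT}$ the composite of $F$ with the inclusion of complete lattices (as poset categories) into $\mathbf{CAT}$; and, for each $M\in\Sigma\text{ -str}$, $\models_M\subseteq F(M)\times|M|$ given by $t\models_M m$ iff $m\in i_M(t)$. Then $I_{(F,i)}$ is an institution. Moreover, when each $i_M$ preserves arbitrary infima, the $\pi$-institution canonically associated to $I_{(F,i)}$ has, for each $M$, closure operator $\mathcal C_M:\mathcal P(|M|)\to\mathcal P(|M|)$ given by $\mathcal C_M(X)=i_M(t_X)$, where $t_X=\bigwedge\{t\in F(M):X\subseteq i_M(t)\}$.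
   Context: A signature $\Sigma=(\Sigma_n)_{n\in\mathbb N}$ is a family of sets of $n$-ary operation symbols; $\Sigma\text{ -str}$ is the category of $\Sigma$-algebras and homomorphisms, and $|M|$ is the underlying set of $M$. A filter pair over $\Sigma$ is a pair $(F,i)$ where $F:(\Sigma\text{ -str})^{op}\to\mathbf{CLat}$ is a contravariant functor into complete lattices (with order-preserving maps) and $i=(i_M:F(M)\to(\mathcal P(|M|),\subseteq))_{M}$ is a natural transformation, naturality meaning $i_M\circ F(f)=f^{ -1}\circ i_N$ for every homomorphism $f:M\to N$. An institution $\langle\mathit{Sig},\mathit{Sen},\mathit{Mod},\models\rangle$ consists of a category $\mathit{Sig}$, functors $\mathit{Sen}:\mathit{Sig}\to\mathbf{Set}$ and $\mathit{Mod}:\mathit{Sig}^{op}\to\mathbf{CAT}$, and relations $\models_\Sigma\subseteq|\mathit{Mod}(\Sigma)|\times\mathit{Sen}(\Sigma)$ such that for every $h:\Sigma\to\Sigma'$, $M'\in|\mathit{Mod}(\Sigma')|$ and $\phi\in\mathit{Sen}(\Sigma)$: $M'\models_{\Sigma'}\mathit{Sen}(h)(\phi)$ iff $\mathit{Mod}(h)(M')\models_\Sigma\phi$. The $\pi$-institution canonically associated to an institution has the same signatures and sentences and closure operators $\Gamma\mapsto\Gamma^{**}$, where for $\Gamma\subseteq\mathit{Sen}(\Sigma)$, $\Gamma^*$ is the class of $\Sigma$-models satisfying all sentences of $\Gamma$, and for a class $K$ of $\Sigma$-models, $K^*$ is the set of sentences satisfied by all models in $K$. -}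

module Defs where

open import Level using (0ℓ; Level)
open import Data.Nat using (ℕ)
open import Data.Product using (_×_; _,_)
open import Data.Vec using (Vec; map)
open import Data.Vec.Properties using (map-id; map-∘)
open import Function using (_∘_; id)
open import Function.Bundles using (_⇔_)
open import Relation.Unary using (Pred; _⊆_; _∈_)
open import Relation.Binary.Bundles using (Poset)
open import Relation.Binary.PropositionalEquality
  using (_≡_; refl; sym; trans; cong)

Signature : Set₁
Signature = ℕ → Set   -- Σ n = set of n-ary operation symbols

record Algebra (Σ : Signature) : Set₁ where
  field
    Carrier : Set
    op      : ∀ {n} → Σ n → Vec Carrier n → Carrier
open Algebra public using (op)

∣_∣ : ∀ {Σ} → Algebra Σ → Set
∣ M ∣ = Algebra.Carrier M

record Hom {Σ : Signature} (M N : Algebra Σ) : Set where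
  field
    fun : ∣ M ∣ → ∣ N ∣
    preserves : ∀ {n} (σ : Σ n) (xs : Vec ∣ M ∣ n) →
                fun (op M σ xs) ≡ op N σ (map fun xs)
open Hom public

idHom : ∀ {Σ} (M : Algebra Σ) → Hom M M
idHom M = record { fun = id ; preserves = λ σ xs → cong (op M σ) (sym (map-id xs)) }

_∘H_ : ∀ {Σ} {L M N : Algebra Σ} → Hom M N → Hom L M → Hom L N
_∘H_ {N = N} g f = record
  { fun = fun g ∘ fun f
  ; preserves = λ σ xs →
      trans (cong (fun g) (preserves f σ xs))
      (trans (preserves g σ (map (fun f) xs))
             (cong (op N σ) (sym (map-∘ (fun g) (fun f) xs))))
  }

record CompleteLattice : Set₂ where
  field
    poset : Poset (Level.suc 0ℓ) 0ℓ 0ℓ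
  open Poset poset public
  field
    ⋀ : Pred (Poset.Carrier poset) 0ℓ → Poset.Carrier poset
    ⋀-lower    : ∀ S {t} → t ∈ S → ⋀ S ≤ t
    ⋀-greatest : ∀ S {u} → (∀ {t} → t ∈ S → u ≤ t) → u ≤ ⋀ S
    ⋁ : Pred (Poset.Carrier poset) 0ℓ → Poset.Carrier poset
    ⋁-upper : ∀ S {t} → t ∈ S → t ≤ ⋁ S
    ⋁-least : ∀ S {u} → (∀ {t} → t ∈ S → t ≤ u) → ⋁ S ≤ u

module CL = CompleteLattice

_≐_ : ∀ {A : Set} {ℓ₁ ℓ₂ : Level} → Pred A ℓ₁ → Pred A ℓ₂ → Set (ℓ₁ Level.⊔ ℓ₂)
X ≐ Y = (X ⊆ Y) × (Y ⊆ X)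

record FilterPair (Σ : Signature) : Set₂ where
  field
    F₀ : Algebra Σ → CompleteLattice
    F₁ : ∀ {M N} → Hom M N → CL.Carrier (F₀ N) → CL.Carrier (F₀ M)
    F₁-mono : ∀ {M N} (f : Hom M N) {t u} →
              CL._≤_ (F₀ N) t u → CL._≤_ (F₀ M) (F₁ f t) (F₁ f u)
    F₁-resp-≈ : ∀ {M N} (f : Hom M N) {t u} →
              CL._≈_ (F₀ N) t u → CL._≈_ (F₀ M) (F₁ f t) (F₁ f u)
    F₁-cong : ∀ {M N} (f g : Hom M N) → (∀ x → fun f x ≡ fun g x) →
              ∀ t → CL._≈_ (F₀ M) (F₁ f t) (F₁ g t)
    F-id : ∀ M t → CL._≈_ (F₀ M) (F₁ (idHom M) t) t
    F-∘  : ∀ {L M N} (g : Hom M N) (f : Hom L M) t →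
           CL._≈_ (F₀ L) (F₁ (g ∘H f) t) (F₁ f (F₁ g t))
    i : ∀ M → CL.Carrier (F₀ M) → Pred ∣ M ∣ 0ℓ
    i-mono : ∀ M {t u} → CL._≤_ (F₀ M) t u → i M t ⊆ i M u
    i-resp-≈ : ∀ M {t u} → CL._≈_ (F₀ M) t u → i M t ≐ i M u
    i-natural : ∀ {M N} (f : Hom M N) (t : CL.Carrier (F₀ N)) →
                i M (F₁ f t) ≐ (λ m → i N t (fun f m))

module InstitutionOf {Σ : Signature} (P : FilterPair Σ) where
  open FilterPair P

  Sig : Set₁
  Sig = Algebra Σ

  Sen : Sig → Set
  Sen M = ∣ M ∣

  Sen₁ : ∀ {M N} → Hom M N → Sen M → Sen N
  Sen₁ f = fun f

  Mod : Sig → CompleteLattice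
  Mod = F₀

  Mod₁ : ∀ {M N} → Hom M N → CL.Carrier (Mod N) → CL.Carrier (Mod M)
  Mod₁ = F₁

  Sat : (M : Sig) → CL.Carrier (Mod M) → Sen M → Set
  Sat M t m = m ∈ i M t

  syntax Sat M t m = t ⊨[ M ] m

  SatisfactionCondition : Set₁
  SatisfactionCondition =
    ∀ {M N} (h : Hom M N) (t : CL.Carrier (Mod N)) (φ : Sen M) →
      (t ⊨[ N ] Sen₁ h φ) ⇔ (Mod₁ h t ⊨[ M ] φ)

  -- Galois connection defining the canonical π-institution
  _* : ∀ {M} → Pred (Sen M) 0ℓ → Pred (CL.Carrier (Mod M)) 0ℓ
  _* {M} Γ t = ∀ φ → φ ∈ Γ → t ⊨[ M ] φ

  _*ᴹ : ∀ {M} → Pred (CL.Carrier (Mod M)) 0ℓ → Pred (Sen M) (Level.suc 0ℓ)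
  _*ᴹ {M} K φ = ∀ t → t ∈ K → t ⊨[ M ] φ

  closure : ∀ M → Pred (Sen M) 0ℓ → Pred (Sen M) (Level.suc 0ℓ)
  closure M Γ = _*ᴹ {M} (_* {M} Γ)

  -- each i_M preserves arbitrary infima (meets in P(|M|) are intersections)
  PreservesInfima : Set₁
  PreservesInfima = ∀ M (S : Pred (CL.Carrier (F₀ M)) 0ℓ) →
    i M (CL.⋀ (F₀ M) S) ≐ (λ m → ∀ t → t ∈ S → m ∈ i M t)

  t[_,_] : ∀ M → Pred ∣ M ∣ 0ℓ → CL.Carrier (F₀ M)
  t[ M , X ] = CL.⋀ (F₀ M) (λ t → X ⊆ i M t)

module Submission where

-- The satisfaction condition  t ⊨_N h(φ) ⇔ F(h)(t) ⊨_M φ  is exactly the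
-- naturality square  i_M ∘ F(h) = h⁻¹ ∘ i_N  read at the sentence φ.
--
-- In any
-- institution of this shape, if a set of sentences Γ has a *least model* t₀
-- (a model of Γ below every other model of Γ), then Γ** is the theory of t₀:
-- every consequence holds in t₀, and since i_M is monotone, whatever holds in
-- t₀ holds in every model of Γ.  Then for X ⊆ |M| the infimum
-- t_X = ⋀ {t : X ⊆ i_M(t)} lies below every model of X, and when i_M
-- preserves infima it is itself a model of X; so it is the least model and
-- C_M(X) = i_M(t_X).

open import Defs
open import Data.Product using (_×_; _,_; proj₁; proj₂)
open import Function.Bundles using (mk⇔)
open import Relation.Unary using (_⊆_)

module _ {Σ : Signature} (P : FilterPair Σ) where
  open FilterPair P
  open InstitutionOf P

  satisfaction : SatisfactionCondition
  satisfaction h t φ = mk⇔ (proj₂ (i-natural h t)) (proj₁ (i-natural h t))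

  IsLeastModel : ∀ M → (Sen M → Set) → CL.Carrier (Mod M) → Set₁
  IsLeastModel M Γ t₀ =
    _* {M} Γ t₀ × (∀ t → _* {M} Γ t → CL._≤_ (Mod M) t₀ t)

  closure-of-least-model : ∀ M (Γ : Sen M → Set) t₀ →
    IsLeastModel M Γ t₀ → closure M Γ ≐ i M t₀
  closure-of-least-model M Γ t₀ (t₀-model , t₀-least) =
    (λ φ∈Γ** → φ∈Γ** t₀ t₀-model) ,
    (λ φ∈t₀ t t-model → i-mono M (t₀-least t t-model) φ∈t₀)

  t-below-models : ∀ M (X : Sen M → Set) t →
    _* {M} X t → CL._≤_ (Mod M) t[ M , X ] t
  t-below-models M X t t-model =
    CL.⋀-lower (F₀ M) (λ u → X ⊆ i M u) (λ {φ} φ∈X → t-model φ φ∈X)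

  t-is-model : PreservesInfima → ∀ M (X : Sen M → Set) → _* {M} X t[ M , X ]
  t-is-model pres M X φ φ∈X =
    proj₂ (pres M (λ u → X ⊆ i M u)) (λ u X⊆u → X⊆u φ∈X)

proposition4p6 : (Σ : Signature) (P : FilterPair Σ) →
    InstitutionOf.SatisfactionCondition P
    × (InstitutionOf.PreservesInfima P →
        ∀ (M : Algebra Σ) (X : InstitutionOf.Sen P M → Set) →
          InstitutionOf.closure P M X ≐ FilterPair.i P M (InstitutionOf.t[_,_] P M X))
proposition4p6 Σ P = satisfaction P , closure-is-i-of-t
  where
  open InstitutionOf P using (t[_,_])

  closure-is-i-of-t : InstitutionOf.PreservesInfima P → ∀ M X →
    InstitutionOf.closure P M X ≐ FilterPair.i P M t[ M , X ]
  closure-is-i-of-t pres M X =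
    closure-of-least-model P M X t[ M , X ]
      (t-is-model P pres M X , t-below-models P M X)
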